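{- Let $p\in(0,1/2]$ and let $R$ be an improper ribbon with edge multiset $E(R)$. Linearize each multiedge $e$ (an edge of multiplicity $\mathrm{mult}(e) \ge 2$) using the identity $\chi_e^{k} = c_0 + c_1\chi_e$ valid on $\{0,1\}$ inputs, and expand the product. Then for each resulting ribbon $S$, the coefficient $c_S$ satisfies \[ |c_S| \le \left(\sqrt{\tfrac{1-p}{p}}\right)^{\sum_{e \in \mathrm{mul}(R)} \left(\mathrm{mult}(e) - 1 - \mathbf{1}_{e \text{ vanishes}}\right)}, \] where $\mathrm{mul}(R)$ is the set of multiedges of $R$ and "$e$ vanishes" means that for $e$ the constant term $c_0$ (rather than the $\chi_e$ term) was chosen.
   Context: The $p$-biased Fourier character is $\chi(0) = -\sqrt{p/(1-p)}$, $\chi(1) = \sqrt{(1-p)/p}$, and for an edge $e$ of a graph $G$ with edge indicator $G_e\in\{0,1\}$, $\chi_e(G) = \chi(G_e)$. An improper ribbon $R$ here consists of ordered sets $A_R, B_R \subseteq [n]$ and a multiset $E(R)$ of edges on $[n]$; its matrix entry (at row $A_R$, column $B_R$) is $\prod_e \chi_e(G)^{\mathrm{mult}(e)}$. For a multiedge of multiplicity $k$, $\chi_e^k = \mathbb{E}[\chi_e^k] + \mathbb{E}[\chi_e^{k+1}]\chi_e$ where expectation is over $G_e \sim \mathrm{Bernoulli}(p)$. -}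

module Defs where

open import Level using (Level; _⊔_) renaming (suc to lsuc)
open import Algebra.Bundles using (CommutativeRing)
open import Relation.Binary.Core using (Rel)
open import Relation.Binary.Definitions using (DecidableEquality)
open import Relation.Binary.Structures using (IsTotalOrder)
open import Relation.Nullary using (¬_)
open import Data.Nat as ℕ using (ℕ; zero; suc; _∸_)
import Data.Nat.Properties as ℕP
open import Data.Bool using (Bool; true; false; if_then_else_)
open import Data.Fin using (Fin) renaming (_<_ to _Fin<_)
import Data.Fin.Properties as FinP
open import Data.Product using (_×_; _,_; proj₁; proj₂)
open import Data.Product.Properties using (≡-dec)
open import Data.List using (List; []; _∷_; filter; length; cartesianProduct; allFin)
open import Data.List.Relation.Unary.All using (All)
open import Data.List.Relation.Unary.Unique.Propositional using (Unique)

-- An ordered field equipped with square roots of non-negative elements.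
-- (The standard library has no real numbers; the statement is made for
-- every such field, which in particular covers ℝ.)

record OrderedField (c ℓ : Level) : Set (lsuc (c ⊔ ℓ)) where
  infix 4 _≤_ _<_
  infix 8 _⁻¹
  field
    commutativeRing : CommutativeRing c ℓ
  open CommutativeRing commutativeRing public
  field
    _≤_           : Rel Carrier ℓ
    isTotalOrder  : IsTotalOrder _≈_ _≤_
    +-mono-≤      : ∀ z {x y} → x ≤ y → x + z ≤ y + z
    *-nonneg      : ∀ {x y} → 0# ≤ x → 0# ≤ y → 0# ≤ x * y
    0≉1           : ¬ (0# ≈ 1#)
    _⁻¹           : Carrier → Carrier
    ⁻¹-inverse    : ∀ {x} → ¬ (x ≈ 0#) → x * x ⁻¹ ≈ 1#
    √             : Carrier → Carrier
    √-nonneg      : ∀ {x} → 0# ≤ x → 0# ≤ √ x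
    √-sq          : ∀ {x} → 0# ≤ x → √ x * √ x ≈ x

  _<_ : Rel Carrier ℓ
  x < y = x ≤ y × ¬ (x ≈ y)

  _/_ : Carrier → Carrier → Carrier
  x / y = x * y ⁻¹

  _^_ : Carrier → ℕ → Carrier
  x ^ zero  = 1#
  x ^ suc k = x * (x ^ k)

  prod : List Carrier → Carrier
  prod []       = 1#
  prod (x ∷ xs) = x * prod xs

-- Edges on [n] = Fin n: pairs (i , j) with i < j (unordered pairs).

Edge : ℕ → Set
Edge n = Fin n × Fin n

_≟E_ : ∀ {n} → DecidableEquality (Edge n)
_≟E_ = ≡-dec FinP._≟_ FinP._≟_

allEdges : (n : ℕ) → List (Edge n)
allEdges n = filter (λ e → proj₁ e FinP.<? proj₂ e) (cartesianProduct (allFin n) (allFin n))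

-- Improper ribbon: ordered sets A_R, B_R ⊆ [n] and a multiset E(R) of edges
-- (a list of edges, each written (i , j) with i < j; repetitions = multiplicity).
record ImproperRibbon (n : ℕ) : Set where
  field
    A      : List (Fin n)
    A-uniq : Unique A
    B      : List (Fin n)
    B-uniq : Unique B
    E      : List (Edge n)
    E-ok   : All (λ e → proj₁ e Fin< proj₂ e) E

open ImproperRibbon public

mult : ∀ {n} → ImproperRibbon n → Edge n → ℕ
mult R e = length (filter (λ f → e ≟E f) (E R))

mul : ∀ {n} → ImproperRibbon n → List (Edge n)
mul {n} R = filter (λ e → 2 ℕP.≤? mult R e) (allEdges n)

module Biased {c ℓ : Level} (F : OrderedField c ℓ) (p : OrderedField.Carrier F) where
  open OrderedField F

  χ1 : Carrier
  χ1 = √ ((1# - p) / p)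

  χ0 : Carrier
  χ0 = - √ (p / (1# - p))

  -- E[χ_e^k] for G_e ~ Bernoulli(p)
  moment : ℕ → Carrier
  moment k = p * (χ1 ^ k) + (1# - p) * (χ0 ^ k)

  -- χ_e^k = c₀ k + c₁ k · χ_e
  c₀ c₁ : ℕ → Carrier
  c₀ k = moment k
  c₁ k = moment (suc k)

  -- A choice for each multiedge: vanish e = true means the constant term c₀
  -- was chosen for e, false means the χ_e term was chosen.
  coeff : ∀ {n} → ImproperRibbon n → (Edge n → Bool) → Carrier
  coeff R vanish = go (mul R)
    where
    go : List _ → Carrier
    go []       = 1#
    go (e ∷ es) = (if vanish e then c₀ (mult R e) else c₁ (mult R e)) * go es

  exponent : ∀ {n} → ImproperRibbon n → (Edge n → Bool) → ℕ
  exponent R vanish = go (mul R)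
    where
    go : List _ → ℕ
    go []       = 0
    go (e ∷ es) = (mult R e ∸ 1 ∸ (if vanish e then 1 else 0)) ℕ.+ go es

  bound : ∀ {n} → ImproperRibbon n → (Edge n → Bool) → Carrier
  bound R vanish = χ1 ^ exponent R vanish

{-# OPTIONS --safe #-}
-- Write q = 1 - p. Since p ≤ q, χ(1) = √(q/p) ≥ 1 and χ(0) = -√(p/q) ∈ [-1, 0], and
-- p χ(1)² = q, q χ(0)² = p. Hence E[χ^(k+2)] = q χ(1)^k + p χ(0)^k has absolute value at most
-- χ(1)^k, while E[χ⁰] = 1 and |E[χ]| ≤ q ≤ 1. The coefficient c_S is the product over the
-- multiedges of E[χ^mult(e)] (e vanishes) or E[χ^(mult(e)+1)] (e survives), so multiplying
-- these bounds gives χ(1) to the power Σ (mult(e) - 1 - 1_{e vanishes}).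
module Submission where

open import Defs
open import Level using (Level)
open import Data.Nat using (ℕ; zero; suc; _∸_)
import Data.Nat as ℕ
open import Data.Nat.Properties using (∸-+-assoc)
open import Data.Bool using (Bool; true; false; if_then_else_)
open import Data.Product using (_×_; _,_; proj₁; proj₂)
open import Data.Sum using (inj₁; inj₂)
open import Data.List using (List; []; _∷_; foldr)
open import Data.List.Properties using (foldr-universal)
open import Function using (_∘_)
open import Relation.Nullary using (¬_; contradiction)
open import Relation.Binary.Bundles using (TotalOrder)
import Relation.Binary.PropositionalEquality as ≡
open ≡ using (_≡_)

module OrderedFieldProperties {c ℓ : Level} (F : OrderedField c ℓ) where

  open OrderedField F

  totalOrder : TotalOrder c ℓ ℓ
  totalOrder = record { isTotalOrder = isTotalOrder }

  open TotalOrder totalOrder public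
    using (total; antisym; poset) renaming (refl to ≤-refl; trans to ≤-trans)
  open import Relation.Binary.Reasoning.PartialOrder poset
  open import Algebra.Properties.Ring ring
    using (-0#≈0#; -‿involutive; -‿+-comm; -‿distribˡ-*; -‿distribʳ-*; [y-z]x≈yx-zx)
  open import Algebra.Solver.Ring.NaturalCoefficients.Default commutativeSemiring
    using (solve; _:=_; _:+_)

  +-mono₂-≤ : ∀ {x y u v} → x ≤ y → u ≤ v → x + u ≤ y + v
  +-mono₂-≤ {x} {y} {u} {v} x≤y u≤v = begin
    x + u ≤⟨ +-mono-≤ u x≤y ⟩
    y + u ≈⟨ +-comm y u ⟩
    u + y ≤⟨ +-mono-≤ y u≤v ⟩
    v + y ≈⟨ +-comm v y ⟩
    y + v ∎

  x≤y⇒0≤y-x : ∀ {x y} → x ≤ y → 0# ≤ y - x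
  x≤y⇒0≤y-x {x} {y} x≤y = begin
    0#    ≈⟨ -‿inverseʳ x ⟨
    x - x ≤⟨ +-mono-≤ (- x) x≤y ⟩
    y - x ∎

  0≤y-x⇒x≤y : ∀ {x y} → 0# ≤ y - x → x ≤ y
  0≤y-x⇒x≤y {x} {y} 0≤y-x = begin
    x             ≈⟨ +-identityˡ x ⟨
    0# + x        ≤⟨ +-mono-≤ x 0≤y-x ⟩
    (y - x) + x   ≈⟨ +-assoc y (- x) x ⟩
    y + (- x + x) ≈⟨ +-congˡ (-‿inverseˡ x) ⟩
    y + 0#        ≈⟨ +-identityʳ y ⟩
    y             ∎

  neg-antimono-≤ : ∀ {x y} → x ≤ y → - y ≤ - x
  neg-antimono-≤ {x} {y} x≤y = begin
    - y                ≈⟨ +-identityˡ (- y) ⟨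
    0# + - y           ≈⟨ +-congʳ (-‿inverseʳ x) ⟨
    (x + - x) + - y    ≈⟨ +-assoc x (- x) (- y) ⟩
    x + (- x + - y)    ≤⟨ +-mono-≤ (- x + - y) x≤y ⟩
    y + (- x + - y)    ≈⟨ solve 3 (λ y a b → y :+ (a :+ b) := a :+ (y :+ b)) refl y (- x) (- y) ⟩
    - x + (y + - y)    ≈⟨ +-congˡ (-‿inverseʳ y) ⟩
    - x + 0#           ≈⟨ +-identityʳ (- x) ⟩
    - x                ∎

  0≤x⇒-x≤0 : ∀ {x} → 0# ≤ x → - x ≤ 0#
  0≤x⇒-x≤0 {x} 0≤x = begin
    - x  ≤⟨ neg-antimono-≤ 0≤x ⟩
    - 0# ≈⟨ -0#≈0# ⟩
    0#   ∎

  x≤0⇒0≤-x : ∀ {x} → x ≤ 0# → 0# ≤ - x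
  x≤0⇒0≤-x {x} x≤0 = begin
    0#   ≈⟨ -0#≈0# ⟨
    - 0# ≤⟨ neg-antimono-≤ x≤0 ⟩
    - x  ∎

  *-monoʳ-≤-nonNeg : ∀ {x y z} → 0# ≤ z → x ≤ y → x * z ≤ y * z
  *-monoʳ-≤-nonNeg {x} {y} {z} 0≤z x≤y = 0≤y-x⇒x≤y (begin
    0#              ≤⟨ *-nonneg (x≤y⇒0≤y-x x≤y) 0≤z ⟩
    (y - x) * z     ≈⟨ [y-z]x≈yx-zx z y x ⟩
    y * z - x * z   ∎)

  *-monoˡ-≤-nonNeg : ∀ {x y z} → 0# ≤ z → x ≤ y → z * x ≤ z * y
  *-monoˡ-≤-nonNeg {x} {y} {z} 0≤z x≤y = begin
    z * x ≈⟨ *-comm z x ⟩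
    x * z ≤⟨ *-monoʳ-≤-nonNeg 0≤z x≤y ⟩
    y * z ≈⟨ *-comm y z ⟩
    z * y ∎

  -x*-x≈x*x : ∀ x → - x * - x ≈ x * x
  -x*-x≈x*x x = begin-equality
    - x * - x     ≈⟨ -‿distribˡ-* x (- x) ⟨
    - (x * - x)   ≈⟨ -‿cong (-‿distribʳ-* x x) ⟨
    - (- (x * x)) ≈⟨ -‿involutive (x * x) ⟩
    x * x         ∎

  x*x-nonNeg : ∀ x → 0# ≤ x * x
  x*x-nonNeg x with total 0# x
  ... | inj₁ 0≤x = *-nonneg 0≤x 0≤x
  ... | inj₂ x≤0 = begin
    0#        ≤⟨ *-nonneg (x≤0⇒0≤-x x≤0) (x≤0⇒0≤-x x≤0) ⟩
    - x * - x ≈⟨ -x*-x≈x*x x ⟩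
    x * x     ∎

  0≤1 : 0# ≤ 1#
  0≤1 = begin
    0#      ≤⟨ x*x-nonNeg 1# ⟩
    1# * 1# ≈⟨ *-identityˡ 1# ⟩
    1#      ∎

  0<x⇒x≉0 : ∀ {x} → 0# < x → ¬ (x ≈ 0#)
  0<x⇒x≉0 (_ , 0≉x) x≈0 = 0≉x (sym x≈0)

  ⁻¹-nonNeg : ∀ {x} → 0# < x → 0# ≤ x ⁻¹
  ⁻¹-nonNeg {x} 0<x@(0≤x , _) with total 0# (x ⁻¹)
  ... | inj₁ 0≤x⁻¹ = 0≤x⁻¹
  ... | inj₂ x⁻¹≤0 = contradiction (antisym 0≤1 1≤0) 0≉1
    where
    1≤0 : 1# ≤ 0#
    1≤0 = begin
      1#                ≈⟨ +-identityˡ 1# ⟨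
      0# + 1#           ≤⟨ +-mono-≤ 1# (*-nonneg 0≤x (x≤0⇒0≤-x x⁻¹≤0)) ⟩
      x * - (x ⁻¹) + 1# ≈⟨ +-congʳ (-‿distribʳ-* x (x ⁻¹)) ⟨
      - (x * x ⁻¹) + 1# ≈⟨ +-congʳ (-‿cong (⁻¹-inverse (0<x⇒x≉0 0<x))) ⟩
      - 1# + 1#         ≈⟨ -‿inverseˡ 1# ⟩
      0#                ∎

  x*[y/x]≈y : ∀ {x} y → ¬ (x ≈ 0#) → x * (y / x) ≈ y
  x*[y/x]≈y {x} y x≉0 = begin-equality
    x * (y * x ⁻¹) ≈⟨ *-assoc x y (x ⁻¹) ⟨
    x * y * x ⁻¹   ≈⟨ *-congʳ (*-comm x y) ⟩
    y * x * x ⁻¹   ≈⟨ *-assoc y x (x ⁻¹) ⟩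
    y * (x * x ⁻¹) ≈⟨ *-congˡ (⁻¹-inverse x≉0) ⟩
    y * 1#         ≈⟨ *-identityʳ y ⟩
    y              ∎

  x≤y⇒1≤y/x : ∀ {x y} → 0# < x → x ≤ y → 1# ≤ y / x
  x≤y⇒1≤y/x {x} {y} 0<x x≤y = begin
    1#         ≈⟨ ⁻¹-inverse (0<x⇒x≉0 0<x) ⟨
    x * x ⁻¹   ≤⟨ *-monoʳ-≤-nonNeg (⁻¹-nonNeg 0<x) x≤y ⟩
    y * x ⁻¹   ∎

  y≤x⇒y/x≤1 : ∀ {x y} → 0# < x → y ≤ x → y / x ≤ 1#
  y≤x⇒y/x≤1 {x} {y} 0<x y≤x = begin
    y * x ⁻¹   ≤⟨ *-monoʳ-≤-nonNeg (⁻¹-nonNeg 0<x) y≤x ⟩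
    x * x ⁻¹   ≈⟨ ⁻¹-inverse (0<x⇒x≉0 0<x) ⟩
    1#         ∎

  1≤x*x⇒1≤x : ∀ {x} → 0# ≤ x → 1# ≤ x * x → 1# ≤ x
  1≤x*x⇒1≤x {x} 0≤x 1≤x*x with total 1# x
  ... | inj₁ 1≤x = 1≤x
  ... | inj₂ x≤1 = begin
    1#      ≤⟨ 1≤x*x ⟩
    x * x   ≤⟨ *-monoˡ-≤-nonNeg 0≤x x≤1 ⟩
    x * 1#  ≈⟨ *-identityʳ x ⟩
    x       ∎

  x*x≤1⇒x≤1 : ∀ {x} → 0# ≤ x → x * x ≤ 1# → x ≤ 1#
  x*x≤1⇒x≤1 {x} 0≤x x*x≤1 with total x 1#
  ... | inj₁ x≤1 = x≤1
  ... | inj₂ 1≤x = begin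
    x       ≈⟨ *-identityʳ x ⟨
    x * 1#  ≤⟨ *-monoˡ-≤-nonNeg 0≤x 1≤x ⟩
    x * x   ≤⟨ x*x≤1 ⟩
    1#      ∎

  ^-nonNeg : ∀ {x} k → 0# ≤ x → 0# ≤ x ^ k
  ^-nonNeg zero    0≤x = 0≤1
  ^-nonNeg (suc k) 0≤x = *-nonneg 0≤x (^-nonNeg k 0≤x)

  ^-distribˡ-+-* : ∀ x m n → x ^ (m ℕ.+ n) ≈ x ^ m * x ^ n
  ^-distribˡ-+-* x zero    n = sym (*-identityˡ (x ^ n))
  ^-distribˡ-+-* x (suc m) n = begin-equality
    x * x ^ (m ℕ.+ n)       ≈⟨ *-congˡ (^-distribˡ-+-* x m n) ⟩
    x * (x ^ m * x ^ n)     ≈⟨ *-assoc x (x ^ m) (x ^ n) ⟨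
    x * x ^ m * x ^ n       ∎

  infix 4 ∣_∣≤_

  ∣_∣≤_ : Carrier → Carrier → Set ℓ
  ∣ x ∣≤ A = - A ≤ x × x ≤ A

  ∣∣≤-resp-≈ : ∀ {x y A B} → x ≈ y → A ≈ B → ∣ x ∣≤ A → ∣ y ∣≤ B
  ∣∣≤-resp-≈ {x} {y} {A} {B} x≈y A≈B (-A≤x , x≤A) =
    (begin - B ≈⟨ -‿cong A≈B ⟨ - A ≤⟨ -A≤x ⟩ x ≈⟨ x≈y ⟩ y ∎) ,
    (begin y ≈⟨ x≈y ⟨ x ≤⟨ x≤A ⟩ A ≈⟨ A≈B ⟩ B ∎)

  ∣∣≤-weaken : ∀ {x A B} → A ≤ B → ∣ x ∣≤ A → ∣ x ∣≤ B
  ∣∣≤-weaken A≤B (-A≤x , x≤A) = ≤-trans (neg-antimono-≤ A≤B) -A≤x , ≤-trans x≤A A≤B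

  0≤x⇒∣x∣≤x : ∀ {x} → 0# ≤ x → ∣ x ∣≤ x
  0≤x⇒∣x∣≤x 0≤x = ≤-trans (0≤x⇒-x≤0 0≤x) 0≤x , ≤-refl

  ∣-x∣≤ : ∀ {x A} → ∣ x ∣≤ A → ∣ - x ∣≤ A
  ∣-x∣≤ {x} {A} (-A≤x , x≤A) =
    neg-antimono-≤ x≤A , (begin - x ≤⟨ neg-antimono-≤ -A≤x ⟩ - - A ≈⟨ -‿involutive A ⟩ A ∎)

  ∣x+y∣≤ : ∀ {x y A B} → ∣ x ∣≤ A → ∣ y ∣≤ B → ∣ x + y ∣≤ A + B
  ∣x+y∣≤ {x} {y} {A} {B} (-A≤x , x≤A) (-B≤y , y≤B) =
    (begin - (A + B) ≈⟨ -‿+-comm A B ⟨ - A + - B ≤⟨ +-mono₂-≤ -A≤x -B≤y ⟩ x + y ∎) ,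
    +-mono₂-≤ x≤A y≤B

  ∣x+y∣≤-opposite-signs : ∀ {x y A} → 0# ≤ x → x ≤ A → - A ≤ y → y ≤ 0# → ∣ x + y ∣≤ A
  ∣x+y∣≤-opposite-signs {x} {y} {A} 0≤x x≤A -A≤y y≤0 =
    (begin - A ≈⟨ +-identityˡ (- A) ⟨ 0# + - A ≤⟨ +-mono₂-≤ 0≤x -A≤y ⟩ x + y ∎) ,
    (begin x + y ≤⟨ +-mono₂-≤ x≤A y≤0 ⟩ A + 0# ≈⟨ +-identityʳ A ⟩ A ∎)

  ∣x*y∣≤-nonNeg : ∀ {x y A B} → 0# ≤ x → x ≤ A → 0# ≤ B → ∣ y ∣≤ B → ∣ x * y ∣≤ A * B
  ∣x*y∣≤-nonNeg {x} {y} {A} {B} 0≤x x≤A 0≤B (-B≤y , y≤B) =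
    (begin
      - (A * B) ≤⟨ neg-antimono-≤ (*-monoʳ-≤-nonNeg 0≤B x≤A) ⟩
      - (x * B) ≈⟨ -‿distribʳ-* x B ⟩
      x * - B   ≤⟨ *-monoˡ-≤-nonNeg 0≤x -B≤y ⟩
      x * y     ∎) ,
    (begin
      x * y ≤⟨ *-monoˡ-≤-nonNeg 0≤x y≤B ⟩
      x * B ≤⟨ *-monoʳ-≤-nonNeg 0≤B x≤A ⟩
      A * B ∎)

  ∣x*y∣≤ : ∀ {x y A B} → 0# ≤ B → ∣ x ∣≤ A → ∣ y ∣≤ B → ∣ x * y ∣≤ A * B
  ∣x*y∣≤ {x} {y} 0≤B ∣x∣≤A@(_ , x≤A) ∣y∣≤B with total 0# x
  ... | inj₁ 0≤x = ∣x*y∣≤-nonNeg 0≤x x≤A 0≤B ∣y∣≤B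
  ... | inj₂ x≤0 = ∣∣≤-resp-≈ -[-x*y]≈x*y refl
        (∣-x∣≤ (∣x*y∣≤-nonNeg (x≤0⇒0≤-x x≤0) (proj₂ (∣-x∣≤ ∣x∣≤A)) 0≤B ∣y∣≤B))
    where
    -[-x*y]≈x*y : - (- x * y) ≈ x * y
    -[-x*y]≈x*y = begin-equality
      - (- x * y)   ≈⟨ -‿cong (-‿distribˡ-* x y) ⟨
      - (- (x * y)) ≈⟨ -‿involutive (x * y) ⟩
      x * y         ∎

  ∣x^k∣≤ : ∀ {x A} k → 0# ≤ A → ∣ x ∣≤ A → ∣ x ^ k ∣≤ A ^ k
  ∣x^k∣≤ zero    0≤A ∣x∣≤A = 0≤x⇒∣x∣≤x 0≤1
  ∣x^k∣≤ (suc k) 0≤A ∣x∣≤A = ∣x*y∣≤ (^-nonNeg k 0≤A) ∣x∣≤A (∣x^k∣≤ k 0≤A ∣x∣≤A)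

  ∣product∣≤^sum : ∀ {a} {X : Set a} {A} (t : X → Carrier) (d : X → ℕ) → 0# ≤ A →
    (∀ x → ∣ t x ∣≤ A ^ d x) → ∀ xs → ∣ foldr (_*_ ∘ t) 1# xs ∣≤ A ^ foldr (ℕ._+_ ∘ d) 0 xs
  ∣product∣≤^sum t d 0≤A ∣t∣≤ []       = 0≤x⇒∣x∣≤x 0≤1
  ∣product∣≤^sum {A = A} t d 0≤A ∣t∣≤ (x ∷ xs) =
    ∣∣≤-resp-≈ refl (sym (^-distribˡ-+-* A (d x) (sum xs)))
      (∣x*y∣≤ (^-nonNeg (sum xs) 0≤A) (∣t∣≤ x) (∣product∣≤^sum t d 0≤A ∣t∣≤ xs))
    where
    sum : List _ → ℕ
    sum = foldr (ℕ._+_ ∘ d) 0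

module Linearization {c ℓ : Level} (F : OrderedField c ℓ) (p : OrderedField.Carrier F)
  (0<p : OrderedField._<_ F (OrderedField.0# F) p)
  (2p≤1 : OrderedField._≤_ F (OrderedField._+_ F p p) (OrderedField.1# F)) where

  open OrderedField F
  open OrderedFieldProperties F
  open Biased F p
  open import Relation.Binary.Reasoning.PartialOrder poset
  open import Algebra.Properties.Ring ring using (-‿distribʳ-*)
  open import Algebra.Solver.Ring.NaturalCoefficients.Default commutativeSemiring
    using (solve; _:=_; _:+_; _:*_)

  q : Carrier
  q = 1# - p

  β : Carrier
  β = √ (p / q)

  0≤p : 0# ≤ p
  0≤p = proj₁ 0<p

  p+q≈1 : p + q ≈ 1#
  p+q≈1 = begin-equality
    p + (1# + - p) ≈⟨ solve 3 (λ p o n → p :+ (o :+ n) := o :+ (p :+ n)) refl p 1# (- p) ⟩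
    1# + (p - p)   ≈⟨ +-congˡ (-‿inverseʳ p) ⟩
    1# + 0#        ≈⟨ +-identityʳ 1# ⟩
    1#             ∎

  p≤q : p ≤ q
  p≤q = begin
    p             ≈⟨ +-identityʳ p ⟨
    p + 0#        ≈⟨ +-congˡ (-‿inverseʳ p) ⟨
    p + (p - p)   ≈⟨ +-assoc p p (- p) ⟨
    (p + p) - p   ≤⟨ +-mono-≤ (- p) 2p≤1 ⟩
    q             ∎

  q≤1 : q ≤ 1#
  q≤1 = begin
    1# - p ≤⟨ +-mono₂-≤ (≤-refl {1#}) (0≤x⇒-x≤0 0≤p) ⟩
    1# + 0# ≈⟨ +-identityʳ 1# ⟩
    1#      ∎

  0<q : 0# < q
  0<q = ≤-trans 0≤p p≤q , λ 0≈q → proj₂ 0<p (antisym 0≤p (begin p ≤⟨ p≤q ⟩ q ≈⟨ 0≈q ⟨ 0# ∎))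

  0≤q/p : 0# ≤ q / p
  0≤q/p = *-nonneg (proj₁ 0<q) (⁻¹-nonNeg 0<p)

  0≤p/q : 0# ≤ p / q
  0≤p/q = *-nonneg 0≤p (⁻¹-nonNeg 0<q)

  0≤χ1 : 0# ≤ χ1
  0≤χ1 = √-nonneg 0≤q/p

  0≤β : 0# ≤ β
  0≤β = √-nonneg 0≤p/q

  p*χ1²≈q : p * (χ1 * χ1) ≈ q
  p*χ1²≈q = trans (*-congˡ (√-sq 0≤q/p))
                  (x*[y/x]≈y q (0<x⇒x≉0 0<p))

  q*β²≈p : q * (β * β) ≈ p
  q*β²≈p = trans (*-congˡ (√-sq 0≤p/q))
                 (x*[y/x]≈y p (0<x⇒x≉0 0<q))

  1≤χ1 : 1# ≤ χ1
  1≤χ1 = 1≤x*x⇒1≤x 0≤χ1 (begin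
    1#      ≤⟨ x≤y⇒1≤y/x 0<p p≤q ⟩
    q / p   ≈⟨ √-sq 0≤q/p ⟨
    χ1 * χ1 ∎)

  β≤1 : β ≤ 1#
  β≤1 = x*x≤1⇒x≤1 0≤β (begin
    β * β   ≈⟨ √-sq 0≤p/q ⟩
    p / q   ≤⟨ y≤x⇒y/x≤1 0<q p≤q ⟩
    1#      ∎)

  moment-bounded : ∀ m → ∣ moment m ∣≤ χ1 ^ (m ∸ 2)
  moment-bounded zero = ∣∣≤-resp-≈ (sym moment0≈1) refl (0≤x⇒∣x∣≤x 0≤1)
    where
    moment0≈1 : p * 1# + q * 1# ≈ 1#
    moment0≈1 = trans (+-cong (*-identityʳ p) (*-identityʳ q)) p+q≈1
  moment-bounded (suc zero) = ∣∣≤-weaken q≤1 (∣x+y∣≤-opposite-signs 0≤pχ1 pχ1≤q -q≤qχ0 qχ0≤0)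
    where
    qχ0≈-qβ : q * (χ0 * 1#) ≈ - (q * β)
    qχ0≈-qβ = trans (*-congˡ (*-identityʳ χ0)) (sym (-‿distribʳ-* q β))

    0≤pχ1 : 0# ≤ p * (χ1 * 1#)
    0≤pχ1 = *-nonneg 0≤p (*-nonneg 0≤χ1 0≤1)

    pχ1≤q : p * (χ1 * 1#) ≤ q
    pχ1≤q = begin
      p * (χ1 * 1#)  ≤⟨ *-monoˡ-≤-nonNeg 0≤p (*-monoˡ-≤-nonNeg 0≤χ1 1≤χ1) ⟩
      p * (χ1 * χ1)  ≈⟨ p*χ1²≈q ⟩
      q              ∎

    -q≤qχ0 : - q ≤ q * (χ0 * 1#)
    -q≤qχ0 = begin
      - q         ≈⟨ -‿cong (*-identityʳ q) ⟨
      - (q * 1#)  ≤⟨ neg-antimono-≤ (*-monoˡ-≤-nonNeg (proj₁ 0<q) β≤1) ⟩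
      - (q * β)   ≈⟨ qχ0≈-qβ ⟨
      q * (χ0 * 1#) ∎

    qχ0≤0 : q * (χ0 * 1#) ≤ 0#
    qχ0≤0 = begin
      q * (χ0 * 1#) ≈⟨ qχ0≈-qβ ⟩
      - (q * β)     ≤⟨ 0≤x⇒-x≤0 (*-nonneg (proj₁ 0<q) 0≤β) ⟩
      0#            ∎
  moment-bounded (suc (suc k)) =
    ∣∣≤-resp-≈ (sym moment≈) bound≈
      (∣x+y∣≤ (0≤x⇒∣x∣≤x (*-nonneg (proj₁ 0<q) (^-nonNeg k 0≤χ1)))
              (∣x*y∣≤ (^-nonNeg k 0≤χ1) (0≤x⇒∣x∣≤x 0≤p) (∣x^k∣≤ k 0≤χ1 ∣χ0∣≤χ1)))
    where
    ∣χ0∣≤χ1 : ∣ χ0 ∣≤ χ1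
    ∣χ0∣≤χ1 = ∣-x∣≤ (∣∣≤-weaken (≤-trans β≤1 1≤χ1) (0≤x⇒∣x∣≤x 0≤β))

    moment≈ : moment (suc (suc k)) ≈ q * χ1 ^ k + p * χ0 ^ k
    moment≈ = +-cong
      (begin-equality
        p * (χ1 * (χ1 * χ1 ^ k)) ≈⟨ solve 3 (λ p a w → p :* (a :* (a :* w)) := (p :* (a :* a)) :* w) refl p χ1 (χ1 ^ k) ⟩
        p * (χ1 * χ1) * χ1 ^ k   ≈⟨ *-congʳ p*χ1²≈q ⟩
        q * χ1 ^ k               ∎)
      (begin-equality
        q * (χ0 * (χ0 * χ0 ^ k)) ≈⟨ solve 3 (λ q a w → q :* (a :* (a :* w)) := (q :* (a :* a)) :* w) refl q χ0 (χ0 ^ k) ⟩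
        q * (χ0 * χ0) * χ0 ^ k   ≈⟨ *-congʳ (*-congˡ (-x*-x≈x*x β)) ⟩
        q * (β * β) * χ0 ^ k     ≈⟨ *-congʳ q*β²≈p ⟩
        p * χ0 ^ k               ∎)

    bound≈ : q * χ1 ^ k + p * χ1 ^ k ≈ χ1 ^ k
    bound≈ = begin-equality
      q * χ1 ^ k + p * χ1 ^ k ≈⟨ distribʳ (χ1 ^ k) q p ⟨
      (q + p) * χ1 ^ k        ≈⟨ *-congʳ (trans (+-comm q p) p+q≈1) ⟩
      1# * χ1 ^ k             ≈⟨ *-identityˡ (χ1 ^ k) ⟩
      χ1 ^ k                  ∎

  chosenCoeff : ∀ {n} → ImproperRibbon n → (Edge n → Bool) → Edge n → Carrier
  chosenCoeff R vanish e = if vanish e then c₀ (mult R e) else c₁ (mult R e)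

  chosenDegree : ∀ {n} → ImproperRibbon n → (Edge n → Bool) → Edge n → ℕ
  chosenDegree R vanish e = mult R e ∸ 1 ∸ (if vanish e then 1 else 0)

  chosenCoeff-bounded : ∀ {n} (R : ImproperRibbon n) vanish e →
    ∣ chosenCoeff R vanish e ∣≤ χ1 ^ chosenDegree R vanish e
  chosenCoeff-bounded R vanish e with vanish e
  ... | true  = ≡.subst (λ k → ∣ c₀ (mult R e) ∣≤ χ1 ^ k) (≡.sym (∸-+-assoc (mult R e) 1 1))
                        (moment-bounded (mult R e))
  ... | false = moment-bounded (suc (mult R e))

  -- The recursions of `coeff` and `exponent` are local to Defs and cannot be named. Abstracting
  -- `mul R` together with `foldr-universal` lets unification find them, with the list variable
  -- outside the context of the unknown function.
  coeff≡product : ∀ {n} (R : ImproperRibbon n) vanish →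
    coeff R vanish ≡ foldr (_*_ ∘ chosenCoeff R vanish) 1# (mul R)
  coeff≡product R vanish
    with mul R | foldr-universal _ (_*_ ∘ chosenCoeff R vanish) 1# ≡.refl (λ _ _ → ≡.refl)
  ... | es | coeff≗foldr = coeff≗foldr es

  exponent≡sum : ∀ {n} (R : ImproperRibbon n) vanish →
    exponent R vanish ≡ foldr (ℕ._+_ ∘ chosenDegree R vanish) 0 (mul R)
  exponent≡sum R vanish
    with mul R | foldr-universal _ (ℕ._+_ ∘ chosenDegree R vanish) 0 ≡.refl (λ _ _ → ≡.refl)
  ... | es | exponent≗foldr = exponent≗foldr es

  coeff-bounded : ∀ {n} (R : ImproperRibbon n) vanish → ∣ coeff R vanish ∣≤ bound R vanish
  coeff-bounded R vanish =
    ≡.subst₂ ∣_∣≤_ (≡.sym (coeff≡product R vanish)) (≡.cong (χ1 ^_) (≡.sym (exponent≡sum R vanish)))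
      (∣product∣≤^sum (chosenCoeff R vanish) (chosenDegree R vanish) 0≤χ1 (chosenCoeff-bounded R vanish) (mul R))

proposition2p43 : {c ℓ : Level} (F : OrderedField c ℓ) (p : OrderedField.Carrier F) →
    OrderedField._<_ F (OrderedField.0# F) p →
    OrderedField._≤_ F (OrderedField._+_ F p p) (OrderedField.1# F) →
    {n : ℕ} (R : ImproperRibbon n) (vanish : Edge n → Bool) →
    OrderedField._≤_ F (OrderedField.-_ F (Biased.bound F p R vanish)) (Biased.coeff F p R vanish)
    × OrderedField._≤_ F (Biased.coeff F p R vanish) (Biased.bound F p R vanish)
proposition2p43 F p 0<p 2p≤1 = Linearization.coeff-bounded F p 0<p 2p≤1
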